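{- Let $r\geq2$ and $0\leq i\leq r-1$. The map $(f_u)_{u\geq0}\mapsto(f_u)_{u\geq1}$ (deleting all zero parts) is a weight-preserving bijection (1) from $\mathcal{A}_{i,r}\setminus\mathcal{A}_{i-1,r}$ onto $\mathcal{T}_{r-i,r}$, (2) from $\mathcal{B}_{i,r}\setminus\tilde{\mathcal{B}}_{i-1,r}$ onto $\mathcal{U}_{r-i,r}$, (3) from $\tilde{\mathcal{B}}_{i,r}\setminus\mathcal{B}_{i-1,r}$ onto $\mathcal{U}_{r-i-1,r}$, with inverse $(f_1,f_2,\ldots)\mapsto(i,f_1,f_2,\ldots)$ (adding $i$ parts equal to $0$).
   Context: Partitions are finite non-increasing sequences of non-negative integers, described by multiplicity sequences $(f_u)_{u\geq0}$; weight $\sum_u uf_u$. For $0\le i\le r-1$: $\mathcal{A}_{i,r}$ is the set of partitions with $f_0\leq i$ and $f_u+f_{u+1}\leq r-1$ for all $u\geq0$; $\mathcal{B}_{i,r}$ is the set of elements of $\mathcal{A}_{i,r}$ such that for all $u\ge 0$, $f_u+f_{u+1}=r-1$ implies $uf_u+(u+1)f_{u+1}\equiv r-1-i\pmod2$; $\tilde{\mathcal{B}}_{i,r}$ is the same with $\equiv r-i\pmod 2$. By convention $\mathcal{A}_{ -1,r}=\mathcal{B}_{ -1,r}=\tilde{\mathcal{B}}_{ -1,r}=\emptyset$. For $1\leq k\leq r$, $\mathcal{T}_{k,r}$ is the set of partitions $(\lambda_1,\ldots,\lambda_\ell)$ into positive parts with $\lambda_j-\lambda_{j+r-1}\geq2$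 for all $j$ and at most $k-1$ parts equal to $1$; $\mathcal{U}_{k,r}$ is the set of partitions into positive parts with $\lambda_j-\lambda_{j+r-1}\geq2$ for all $j$, $\lambda_j-\lambda_{j+r-2}\leq1$ only if $\lambda_j+\cdots+\lambda_{j+r-2}\equiv k-1\pmod2$, and at most $k-1$ parts equal to $1$; and $\mathcal{U}_{0,r}=\emptyset$. A partition into positive parts is identified with its multiplicity sequence $(f_u)_{u\geq1}$. -}

module Defs where

open import Data.Nat using (ℕ; zero; suc; _+_; _*_; _∸_; _≤_; _<_; _≥_; _%_; _≟_; _≤?_)
open import Data.Nat.ListAction using (sum)
open import Data.List using (List; []; _∷_; length; filter; take; drop; lookup; replicate; _++_)
open import Data.List.Relation.Unary.Linked using (Linked)
open import Data.List.Relation.Unary.All using (All)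
open import Data.Fin using (Fin; toℕ)
open import Data.Product using (_×_)
open import Data.Empty using (⊥)
open import Relation.Binary.PropositionalEquality using (_≡_)

-- A partition (with possibly zero parts) is a finite non-increasing list of naturals.
NonIncreasing : List ℕ → Set
NonIncreasing = Linked (λ a b → b ≤ a)

mult : ℕ → List ℕ → ℕ
mult u ps = length (filter (λ x → x ≟ u) ps)

weight : List ℕ → ℕ
weight = sum

removeZeros : List ℕ → List ℕ
removeZeros = filter (λ x → 1 ≤? x)

addZeros : ℕ → List ℕ → List ℕ
addZeros i μ = μ ++ replicate i 0

A : ℕ → ℕ → List ℕ → Set
A i r ps = NonIncreasing ps × mult 0 ps ≤ i
         × (∀ u → mult u ps + mult (suc u) ps ≤ r ∸ 1)

Bgen : ℕ → ℕ → ℕ → List ℕ → Set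
Bgen c i r ps = A i r ps
  × (∀ u → mult u ps + mult (suc u) ps ≡ r ∸ 1 →
       (u * mult u ps + suc u * mult (suc u) ps) % 2 ≡ c % 2)

B : ℕ → ℕ → List ℕ → Set
B i r = Bgen (r ∸ 1 ∸ i) i r

B̃ : ℕ → ℕ → List ℕ → Set
B̃ i r = Bgen (r ∸ i) i r

-- S_{i-1,r} with the convention S_{-1,r} = ∅
Prev : (ℕ → ℕ → List ℕ → Set) → ℕ → ℕ → List ℕ → Set
Prev S zero r ps = ⊥
Prev S (suc i) r ps = S i r ps

-- positive-part partitions with λ_j - λ_{j+r-1} ≥ 2 (0-based positions)
GapCond : ℕ → List ℕ → Set
GapCond r ps = ∀ (j j' : Fin (length ps)) → toℕ j' ≡ toℕ j + (r ∸ 1) →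
  2 + lookup ps j' ≤ lookup ps j

T : ℕ → ℕ → List ℕ → Set
T k r ps = NonIncreasing ps × All (λ x → 1 ≤ x) ps × GapCond r ps × mult 1 ps ≤ k ∸ 1

U : ℕ → ℕ → List ℕ → Set
U zero r ps = ⊥
U (suc k') r ps = T (suc k') r ps
  × (∀ (j j' : Fin (length ps)) → toℕ j' ≡ toℕ j + (r ∸ 2) →
       lookup ps j ∸ lookup ps j' ≤ 1 →
       sum (take (r ∸ 1) (drop (toℕ j) ps)) % 2 ≡ k' % 2)

_∖_ : (List ℕ → Set) → (List ℕ → Set) → List ℕ → Set
(S ∖ S') ps = S ps × (S' ps → ⊥)

record WPBij (S T' : List ℕ → Set) (i : ℕ) : Set where
  field
    forward     : ∀ ps → S ps → T' (removeZeros ps)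
    weight-pres : ∀ ps → S ps → weight (removeZeros ps) ≡ weight ps
    backward    : ∀ μ → T' μ → S (addZeros i μ)
    left-inv    : ∀ ps → S ps → addZeros i (removeZeros ps) ≡ ps
    right-inv   : ∀ μ → T' μ → removeZeros (addZeros i μ) ≡ μ

{-# OPTIONS --safe #-}
module Submission where

-- Deleting zeros and adding i zeros are mutually inverse on partitions with exactly f₀ = i,
-- and each of the three differences consists of such partitions: a member with f₀ < i already
-- lies in the family indexed by i - 1, whose parity residue agrees with the current one
-- modulo 2.  It remains to translate conditions on (f_u) into conditions on the positive parts.
-- In a non-increasing λ, parts λ_j ≥ … ≥ λ_{j+m} with λ_j - λ_{j+m} ≤ 1 exist exactly when
-- f_u + f_{u+1} ≥ m + 1 for some u, so the gap condition says f_u + f_{u+1} ≤ r - 1 for all u.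
-- When f_u + f_{u+1} = r - 1, such r - 1 consecutive parts are all the parts equal to u or
-- u + 1, so their sum is u f_u + (u+1) f_{u+1}: the parity conditions of ℬ and 𝒰 agree.
-- At u = 0, where f₀ = i, the bound reads f₁ ≤ r - 1 - i; the parity condition there holds
-- automatically for ℬ_{i,r} and rules out f₁ = r - 1 - i for ℬ̃_{i,r}.

open import Defs
open import Data.Nat using (ℕ; zero; suc; _+_; _*_; _∸_; _⊓_; _≤_; _<_; _%_; _≟_; _≤?_; z≤n; s≤s)
open import Data.Nat.Properties
open import Data.Nat.ListAction using (sum)
open import Data.Nat.Tactic.RingSolver using (solve-∀)
open import Data.Fin using (Fin; toℕ; zero; suc)
open import Data.Fin.Properties using (toℕ<n)
open import Data.List using (List; []; _∷_; length; filter; take; drop; lookup; replicate; _++_)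
open import Data.List.Properties
  using (filter-accept; filter-reject; filter-none; filter-++; length-++; length-take; length-drop)
open import Data.List.Membership.Propositional.Properties using (∈-lookup)
open import Data.List.Relation.Binary.Sublist.Propositional using (_⊆_; ⊆-refl; ⊆-trans)
open import Data.List.Relation.Binary.Sublist.Propositional.Properties
  using (filter⁺; length-mono-≤; take-⊆; drop-⊆; ++⁺ʳ)
open import Data.List.Relation.Unary.All as All using (All; []; _∷_)
import Data.List.Relation.Unary.All.Properties as AllP
open import Data.List.Relation.Unary.Linked as Linked using ([]; [-]; _∷_)
import Data.List.Relation.Unary.Linked.Properties as LinkedP
open import Data.Product using (_×_; _,_; proj₁; proj₂; Σ)
open import Data.Sum using (_⊎_; inj₁; inj₂)
open import Function using (_∘_; flip)
open import Relation.Nullary using (¬_; yes; no; contradiction)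
open import Relation.Binary.PropositionalEquality

+-squeeze : ∀ {a b c d} → a ≤ c → b ≤ d → c + d ≤ a + b → a ≡ c × b ≡ d
+-squeeze {a} {b} {c} {d} a≤c b≤d c+d≤a+b =
  ≤-antisym a≤c (+-cancelʳ-≤ d c a (≤-trans c+d≤a+b (+-monoʳ-≤ a b≤d))) ,
  ≤-antisym b≤d (+-cancelˡ-≤ c d b (≤-trans c+d≤a+b (+-monoˡ-≤ b a≤c)))

+⇒∸ : ∀ i {k m} → i + k ≡ m → m ∸ i ≡ k
+⇒∸ i {k} i+k≡m = trans (cong (_∸ i) (sym i+k≡m)) (m+n∸m≡n i k)

%2-suc-≢ : ∀ n → n % 2 ≢ suc n % 2
%2-suc-≢ zero ()
%2-suc-≢ (suc n) e = %2-suc-≢ n (sym e)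

AllPositive : List ℕ → Set
AllPositive = All (λ x → 1 ≤ x)

positive⇒≢0 : ∀ {x} → 1 ≤ x → x ≢ 0
positive⇒≢0 (s≤s _) ()

pairCount : ℕ → List ℕ → ℕ
pairCount u xs = mult u xs + mult (suc u) xs

pairWeight : ℕ → List ℕ → ℕ
pairWeight u xs = u * mult u xs + suc u * mult (suc u) xs

InPair : ℕ → ℕ → Set
InPair u x = x ≡ u ⊎ x ≡ suc u

mult-∷-≡ : ∀ {u x} xs → x ≡ u → mult u (x ∷ xs) ≡ suc (mult u xs)
mult-∷-≡ {u} xs x≡u = cong length (filter-accept (_≟ u) x≡u)

mult-∷-≢ : ∀ {u x} xs → x ≢ u → mult u (x ∷ xs) ≡ mult u xs
mult-∷-≢ {u} xs x≢u = cong length (filter-reject (_≟ u) x≢u)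

mult-mono : ∀ u {xs ys} → xs ⊆ ys → mult u xs ≤ mult u ys
mult-mono u = length-mono-≤ ∘ filter⁺ (_≟ u) (_≟ u) (λ { refl x≡u → x≡u })

pairCount-mono : ∀ u {xs ys} → xs ⊆ ys → pairCount u xs ≤ pairCount u ys
pairCount-mono u xs⊆ys = +-mono-≤ (mult-mono u xs⊆ys) (mult-mono (suc u) xs⊆ys)

mult-++ : ∀ u xs ys → mult u (xs ++ ys) ≡ mult u xs + mult u ys
mult-++ u xs ys = trans (cong length (filter-++ (_≟ u) xs ys)) (length-++ (filter (_≟ u) xs))

mult-none : ∀ {u xs} → All (_≢ u) xs → mult u xs ≡ 0
mult-none {u} xs≢u = cong length (filter-none (_≟ u) xs≢u)

mult-replicate : ∀ u i → mult u (replicate i u) ≡ i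
mult-replicate u zero = refl
mult-replicate u (suc i) = trans (mult-∷-≡ (replicate i u) refl) (cong suc (mult-replicate u i))

pairCount-∷-inPair : ∀ {u x} xs → InPair u x → pairCount u (x ∷ xs) ≡ suc (pairCount u xs)
pairCount-∷-inPair {u} xs (inj₁ refl) =
  cong₂ _+_ (mult-∷-≡ {u} xs refl) (mult-∷-≢ {suc u} xs (1+n≢n ∘ sym))
pairCount-∷-inPair {u} xs (inj₂ refl) =
  trans (cong₂ _+_ (mult-∷-≢ {u} xs 1+n≢n) (mult-∷-≡ {suc u} xs refl)) (+-suc (mult u xs) _)

pairWeight-∷-inPair : ∀ {u x} xs → InPair u x → pairWeight u (x ∷ xs) ≡ x + pairWeight u xs
pairWeight-∷-inPair {u} xs (inj₁ refl) = begin
  u * mult u (u ∷ xs) + suc u * mult (suc u) (u ∷ xs)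
    ≡⟨ cong₂ (λ a b → u * a + suc u * b) (mult-∷-≡ {u} xs refl) (mult-∷-≢ {suc u} xs (1+n≢n ∘ sym)) ⟩
  u * suc (mult u xs) + suc u * mult (suc u) xs
    ≡⟨ distrib u (mult u xs) (mult (suc u) xs) ⟩
  u + pairWeight u xs ∎
  where
  open ≡-Reasoning
  distrib : ∀ u a b → u * suc a + suc u * b ≡ u + (u * a + suc u * b)
  distrib = solve-∀
pairWeight-∷-inPair {u} xs (inj₂ refl) = begin
  u * mult u (suc u ∷ xs) + suc u * mult (suc u) (suc u ∷ xs)
    ≡⟨ cong₂ (λ a b → u * a + suc u * b) (mult-∷-≢ {u} xs 1+n≢n) (mult-∷-≡ {suc u} xs refl) ⟩
  u * mult u xs + suc u * suc (mult (suc u) xs)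
    ≡⟨ distrib u (mult u xs) (mult (suc u) xs) ⟩
  suc u + pairWeight u xs ∎
  where
  open ≡-Reasoning
  distrib : ∀ u a b → u * a + suc u * suc b ≡ suc u + (u * a + suc u * b)
  distrib = solve-∀

pairCount-∷-∉ : ∀ {u x} xs → x ≢ u → x ≢ suc u → pairCount u (x ∷ xs) ≡ pairCount u xs
pairCount-∷-∉ xs x≢u x≢1+u = cong₂ _+_ (mult-∷-≢ xs x≢u) (mult-∷-≢ xs x≢1+u)

pairCount-∷-≤ : ∀ u x xs → pairCount u (x ∷ xs) ≤ suc (pairCount u xs)
pairCount-∷-≤ u x xs with x ≟ u | x ≟ suc u
... | yes x≡u | _ = ≤-reflexive (pairCount-∷-inPair xs (inj₁ x≡u))
... | no _ | yes x≡1+u = ≤-reflexive (pairCount-∷-inPair xs (inj₂ x≡1+u))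
... | no x≢u | no x≢1+u = m≤n⇒m≤1+n (≤-reflexive (pairCount-∷-∉ xs x≢u x≢1+u))

pairCount-inPair : ∀ {u w} → All (InPair u) w → pairCount u w ≡ length w
pairCount-inPair [] = refl
pairCount-inPair (p ∷ ps) = trans (pairCount-∷-inPair _ p) (cong suc (pairCount-inPair ps))

sum-inPair : ∀ {u w} → All (InPair u) w → sum w ≡ pairWeight u w
sum-inPair {u} [] = sym (cong₂ _+_ (*-zeroʳ u) (*-zeroʳ (suc u)))
sum-inPair {w = x ∷ w} (p ∷ ps) = trans (cong (x +_) (sum-inPair ps)) (sym (pairWeight-∷-inPair w p))

between⇒inPair : ∀ {u x} → u ≤ x → x ≤ suc u → InPair u x
between⇒inPair u≤x x≤1+u with m≤n⇒m<n∨m≡n u≤x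
... | inj₂ u≡x = inj₁ (sym u≡x)
... | inj₁ u<x = inj₂ (≤-antisym x≤1+u u<x)

nonIncreasing-head : ∀ {x xs} → NonIncreasing (x ∷ xs) → All (_≤ x) (x ∷ xs)
nonIncreasing-head = LinkedP.Linked⇒All (flip ≤-trans) ≤-refl

removeZeros-nonIncreasing : ∀ {xs} → NonIncreasing xs → NonIncreasing (removeZeros xs)
removeZeros-nonIncreasing = LinkedP.filter⁺ (1 ≤?_) (flip ≤-trans)

removeZeros-positive : ∀ xs → AllPositive (removeZeros xs)
removeZeros-positive = AllP.all-filter (1 ≤?_)

weight-removeZeros : ∀ xs → weight (removeZeros xs) ≡ weight xs
weight-removeZeros [] = refl
weight-removeZeros (zero ∷ xs) = weight-removeZeros xs
weight-removeZeros (suc x ∷ xs) = cong (suc x +_) (weight-removeZeros xs)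

mult-suc-removeZeros : ∀ u xs → mult (suc u) (removeZeros xs) ≡ mult (suc u) xs
mult-suc-removeZeros u [] = refl
mult-suc-removeZeros u (zero ∷ xs) = mult-suc-removeZeros u xs
mult-suc-removeZeros u (suc x ∷ xs) with suc x ≟ suc u
... | yes eq = trans (mult-∷-≡ _ eq) (trans (cong suc (mult-suc-removeZeros u xs)) (sym (mult-∷-≡ xs eq)))
... | no neq = trans (mult-∷-≢ _ neq) (trans (mult-suc-removeZeros u xs) (sym (mult-∷-≢ xs neq)))

removeZeros-addZeros : ∀ i {μ} → AllPositive μ → removeZeros (addZeros i μ) ≡ μ
removeZeros-addZeros zero [] = refl
removeZeros-addZeros (suc i) [] = removeZeros-addZeros i []
removeZeros-addZeros i {suc x ∷ μ} (_ ∷ pos) = cong (suc x ∷_) (removeZeros-addZeros i pos)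

removeZeros-zeros : ∀ {xs} → All (_≤ 0) xs → removeZeros xs ≡ []
removeZeros-zeros = filter-none (1 ≤?_) ∘ All.map (λ x≤0 1≤x → 1+n≰n (≤-trans 1≤x x≤0))

replicate-zeros : ∀ {xs} → All (_≤ 0) xs → replicate (mult 0 xs) 0 ≡ xs
replicate-zeros [] = refl
replicate-zeros (z≤n ∷ below) = cong (0 ∷_) (replicate-zeros below)

addZeros-removeZeros : ∀ {xs} → NonIncreasing xs → addZeros (mult 0 xs) (removeZeros xs) ≡ xs
addZeros-removeZeros {[]} _ = refl
addZeros-removeZeros {zero ∷ xs} l =
  trans (cong (addZeros (mult 0 (zero ∷ xs))) (removeZeros-zeros below)) (replicate-zeros below)
  where below = nonIncreasing-head l
addZeros-removeZeros {suc x ∷ xs} l =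
  cong (suc x ∷_) (addZeros-removeZeros (Linked.tail l))

replicate-nonIncreasing : ∀ i x → NonIncreasing (replicate i x)
replicate-nonIncreasing zero x = []
replicate-nonIncreasing (suc zero) x = [-]
replicate-nonIncreasing (suc (suc i)) x = ≤-refl ∷ replicate-nonIncreasing (suc i) x

addZeros-nonIncreasing : ∀ i {μ} → NonIncreasing μ → NonIncreasing (addZeros i μ)
addZeros-nonIncreasing i [] = replicate-nonIncreasing i 0
addZeros-nonIncreasing zero [-] = [-]
addZeros-nonIncreasing (suc i) [-] = z≤n ∷ replicate-nonIncreasing (suc i) 0
addZeros-nonIncreasing i (y≤x ∷ l) = y≤x ∷ addZeros-nonIncreasing i l

mult-zero-addZeros : ∀ i {μ} → AllPositive μ → mult 0 (addZeros i μ) ≡ i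
mult-zero-addZeros i {μ} pos = begin
  mult 0 (μ ++ replicate i 0)         ≡⟨ mult-++ 0 μ (replicate i 0) ⟩
  mult 0 μ + mult 0 (replicate i 0)
    ≡⟨ cong₂ _+_ (mult-none (All.map positive⇒≢0 pos)) (mult-replicate 0 i) ⟩
  i                                   ∎
  where open ≡-Reasoning

mult-suc-addZeros : ∀ u i {μ} → AllPositive μ → mult (suc u) (addZeros i μ) ≡ mult (suc u) μ
mult-suc-addZeros u i {μ} pos = begin
  mult (suc u) (addZeros i μ)                 ≡⟨ mult-suc-removeZeros u (addZeros i μ) ⟨
  mult (suc u) (removeZeros (addZeros i μ))   ≡⟨ cong (mult (suc u)) (removeZeros-addZeros i pos) ⟩
  mult (suc u) μ                              ∎
  where open ≡-Reasoning

pairCount-zero-addZeros : ∀ i {μ} → AllPositive μ → pairCount 0 (addZeros i μ) ≡ i + mult 1 μ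
pairCount-zero-addZeros i pos = cong₂ _+_ (mult-zero-addZeros i pos) (mult-suc-addZeros 0 i pos)

pairWeight-zero-addZeros : ∀ i {μ} → AllPositive μ → pairWeight 0 (addZeros i μ) ≡ mult 1 μ
pairWeight-zero-addZeros i pos = trans (+-identityʳ _) (mult-suc-addZeros 0 i pos)

pairCount-suc-addZeros : ∀ u i {μ} → AllPositive μ →
  pairCount (suc u) (addZeros i μ) ≡ pairCount (suc u) μ
pairCount-suc-addZeros u i pos = cong₂ _+_ (mult-suc-addZeros u i pos) (mult-suc-addZeros (suc u) i pos)

-- Windows of consecutive parts

lookup-≤-head : ∀ {x xs} → NonIncreasing (x ∷ xs) → ∀ j → lookup (x ∷ xs) j ≤ x
lookup-≤-head l j = All.lookup (nonIncreasing-head l) (∈-lookup j)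

window-bounded : ∀ {μ m} → NonIncreasing μ → (j j' : Fin (length μ)) → toℕ j' ≡ toℕ j + m →
  All (λ x → lookup μ j' ≤ x × x ≤ lookup μ j) (take (suc m) (drop (toℕ j) μ))
window-bounded {_ ∷ _} l (suc j) (suc j') e = window-bounded (Linked.tail l) j j' (suc-injective e)
window-bounded {_ ∷ _} {zero} l zero zero e = (≤-refl , ≤-refl) ∷ []
window-bounded {x ∷ y ∷ μ} {suc m} l@(y≤x ∷ l') zero (suc j') e =
  (lookup-≤-head l (suc j') , ≤-refl)
  ∷ All.map (λ (lo , hi) → lo , ≤-trans hi y≤x) (window-bounded l' zero j' (suc-injective e))

window-length : ∀ {μ : List ℕ} {m} (j j' : Fin (length μ)) → toℕ j' ≡ toℕ j + m →
  length (take (suc m) (drop (toℕ j) μ)) ≡ suc m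
window-length {μ} {m} j j' e = begin
  length (take (suc m) (drop (toℕ j) μ))   ≡⟨ length-take (suc m) (drop (toℕ j) μ) ⟩
  suc m ⊓ length (drop (toℕ j) μ)          ≡⟨ cong (suc m ⊓_) (length-drop (toℕ j) μ) ⟩
  suc m ⊓ (length μ ∸ toℕ j)               ≡⟨ m≤n⇒m⊓n≡m fits ⟩
  suc m                                    ∎
  where
  open ≡-Reasoning
  fits : suc m ≤ length μ ∸ toℕ j
  fits = m+n≤o⇒m≤o∸n (suc m) (subst (_≤ length μ) (cong suc (trans e (+-comm (toℕ j) m))) (toℕ<n j'))

record PairWindow (u m : ℕ) (μ : List ℕ) : Set where
  constructor pairWindow
  field
    start end   : Fin (length μ)
    end≡start+m : toℕ end ≡ toℕ start + m
    start≤1+u   : lookup μ start ≤ suc u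
    u≤end       : u ≤ lookup μ end

  window : List ℕ
  window = take (suc m) (drop (toℕ start) μ)

  window-⊆ : window ⊆ μ
  window-⊆ = ⊆-trans (take-⊆ (suc m) _) (drop-⊆ (toℕ start) μ)

  window-inPair : NonIncreasing μ → All (InPair u) window
  window-inPair l = All.map (λ (lo , hi) → between⇒inPair (≤-trans u≤end lo) (≤-trans hi start≤1+u))
                            (window-bounded l start end end≡start+m)

  pairCount-window : NonIncreasing μ → pairCount u window ≡ suc m
  pairCount-window l = trans (pairCount-inPair (window-inPair l)) (window-length start end end≡start+m)

module _ {u m μ} (l : NonIncreasing μ) (w : PairWindow u m μ) where
  open PairWindow w

  pairWindow⇒pairCount≥ : suc m ≤ pairCount u μ
  pairWindow⇒pairCount≥ = subst (_≤ pairCount u μ) (pairCount-window l) (pairCount-mono u window-⊆)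

  pairWindow-sum : pairCount u μ ≤ suc m → sum window ≡ pairWeight u μ
  pairWindow-sum bound = begin
    sum window            ≡⟨ sum-inPair (window-inPair l) ⟩
    pairWeight u window   ≡⟨ cong₂ (λ a b → u * a + suc u * b) (proj₁ exhaust) (proj₂ exhaust) ⟩
    pairWeight u μ        ∎
    where
    open ≡-Reasoning
    exhaust : mult u window ≡ mult u μ × mult (suc u) window ≡ mult (suc u) μ
    exhaust = +-squeeze (mult-mono u window-⊆) (mult-mono (suc u) window-⊆)
                        (≤-trans bound (≤-reflexive (sym (pairCount-window l))))

pairCount-below : ∀ {u x xs} → NonIncreasing (x ∷ xs) → x < u → pairCount u (x ∷ xs) ≡ 0
pairCount-below l x<u =
  cong₂ _+_ (mult-none (All.map <⇒≢ below)) (mult-none (All.map (<⇒≢ ∘ m<n⇒m<1+n) below))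
  where below = All.map (λ y≤x → ≤-<-trans y≤x x<u) (nonIncreasing-head l)

pairCount⇒head≥ : ∀ {u x xs} → NonIncreasing (x ∷ xs) → 0 < pairCount u (x ∷ xs) → u ≤ x
pairCount⇒head≥ {u} {x} l 0<count with u ≤? x
... | yes u≤x = u≤x
... | no u≰x = contradiction (pairCount-below l (≰⇒> u≰x)) (≢-sym (<⇒≢ 0<count))

pairCount⇒lookup≥ : ∀ {u μ} → NonIncreasing μ → ∀ m → suc m ≤ pairCount u μ →
  Σ (Fin (length μ)) λ j → toℕ j ≡ m × u ≤ lookup μ j
pairCount⇒lookup≥ {μ = x ∷ μ} l zero count = zero , refl , pairCount⇒head≥ l count
pairCount⇒lookup≥ {u} {x ∷ μ} l (suc m) count
  with j , j≡m , u≤ ← pairCount⇒lookup≥ (Linked.tail l) m (≤-pred (≤-trans count (pairCount-∷-≤ u x μ)))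
  = suc j , cong suc j≡m , u≤

pairCount⇒pairWindow : ∀ {u m μ} → NonIncreasing μ → suc m ≤ pairCount u μ → PairWindow u m μ
pairCount⇒pairWindow {u} {m} {x ∷ μ} l count with suc u <? x
... | yes 1+u<x = shift (pairCount⇒pairWindow (Linked.tail l) (subst (suc m ≤_) skip count))
  where
  skip : pairCount u (x ∷ μ) ≡ pairCount u μ
  skip = pairCount-∷-∉ {u} {x} μ (λ { refl → 1+n≰n (<⇒≤ 1+u<x) }) (λ { refl → <-irrefl refl 1+u<x })
  shift : PairWindow u m μ → PairWindow u m (x ∷ μ)
  shift (pairWindow s e e≡s+m s≤ ≤e) = pairWindow (suc s) (suc e) (cong suc e≡s+m) s≤ ≤e
... | no 1+u≮x with j , j≡m , u≤ ← pairCount⇒lookup≥ l m count = pairWindow zero j j≡m (≮⇒≥ 1+u≮x) u≤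

-- The gap and parity conditions

gap⇒pairCount≤ : ∀ {m μ} → NonIncreasing μ → GapCond (suc m) μ → ∀ u → pairCount u μ ≤ m
gap⇒pairCount≤ l gap u = ≮⇒≥ λ m<count →
  let open PairWindow (pairCount⇒pairWindow l m<count)
  in 1+n≰n (≤-trans (gap start end end≡start+m) (≤-trans start≤1+u (s≤s u≤end)))

pairCount≤⇒gap : ∀ {m μ} → NonIncreasing μ → (∀ u → pairCount u μ ≤ m) → GapCond (suc m) μ
pairCount≤⇒gap {μ = μ} l bound j j' e = ≮⇒≥ λ close →
  1+n≰n (≤-trans (pairWindow⇒pairCount≥ l (pairWindow j j' e (≤-pred close) ≤-refl))
                 (bound (lookup μ j')))

-- PairParity c (r ∸ 1) u is the condition at u in Bgen c _ r, and WindowParity k (r ∸ 2) is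
-- the second component of U (suc k) r.
PairParity : ℕ → ℕ → ℕ → List ℕ → Set
PairParity c m u xs = pairCount u xs ≡ m → pairWeight u xs % 2 ≡ c % 2

WindowParity : ℕ → ℕ → List ℕ → Set
WindowParity c n μ = ∀ (j j' : Fin (length μ)) → toℕ j' ≡ toℕ j + n →
  lookup μ j ∸ lookup μ j' ≤ 1 → sum (take (suc n) (drop (toℕ j) μ)) % 2 ≡ c % 2

pairParity-cong : ∀ {c m u xs ys} → mult u xs ≡ mult u ys → mult (suc u) xs ≡ mult (suc u) ys →
  PairParity c m u xs → PairParity c m u ys
pairParity-cong {c} {u = u} eu esu par count≡ =
  subst₂ (λ a b → (u * a + suc u * b) % 2 ≡ c % 2) eu esu (par (trans (cong₂ _+_ eu esu) count≡))

windowParity⇒pairParity : ∀ {c n μ} → NonIncreasing μ → WindowParity c n μ →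
  ∀ u → PairParity c (suc n) u μ
windowParity⇒pairParity {n = n} {μ} l par u count≡ =
  trans (cong (_% 2) (sym (pairWindow-sum l w (≤-reflexive count≡)))) (par start end end≡start+m close)
  where
  w : PairWindow u n μ
  w = pairCount⇒pairWindow l (≤-reflexive (sym count≡))
  open PairWindow w
  close : lookup μ start ∸ lookup μ end ≤ 1
  close = ≤-trans (∸-mono start≤1+u u≤end) (≤-reflexive (m+n∸n≡m 1 u))

pairParity⇒windowParity : ∀ {c n μ} → NonIncreasing μ → AllPositive μ →
  (∀ u → pairCount u μ ≤ suc n) → (∀ u → PairParity c (suc n) (suc u) μ) → WindowParity c n μ
pairParity⇒windowParity {c} {n} {μ} l pos bound par j j' e close =
  trans (cong (_% 2) (pairWindow-sum l w (bound v))) (parityAt v (All.lookup pos (∈-lookup j')) count≡)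
  where
  v = lookup μ j'
  start≤1+v : lookup μ j ≤ suc v
  start≤1+v = ≤-trans (m≤n+m∸n _ v) (≤-trans (+-monoʳ-≤ v close) (≤-reflexive (+-comm v 1)))
  w : PairWindow v n μ
  w = pairWindow j j' e start≤1+v ≤-refl
  count≡ : pairCount v μ ≡ suc n
  count≡ = ≤-antisym (bound v) (pairWindow⇒pairCount≥ l w)
  parityAt : ∀ v → 1 ≤ v → PairParity c (suc n) v μ
  parityAt (suc u) _ = par u

A-addZeros⇒pairCount≤ : ∀ {m i μ} → A i (suc m) (addZeros i μ) → ∀ u → pairCount u μ ≤ m
A-addZeros⇒pairCount≤ {i = i} {μ} (_ , _ , bound) u =
  ≤-trans (pairCount-mono u {μ} (++⁺ʳ (replicate i 0) ⊆-refl)) (bound u)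

A-addZeros⇒T : ∀ {m i k μ} → NonIncreasing μ → AllPositive μ → A i (suc m) (addZeros i μ) →
  mult 1 μ ≤ k ∸ 1 → T k (suc m) μ
A-addZeros⇒T l pos a m1 = l , pos , pairCount≤⇒gap l (A-addZeros⇒pairCount≤ a) , m1

A-addZeros⇒mult1≤ : ∀ {m i k μ} → i + k ≡ m → AllPositive μ → A i (suc m) (addZeros i μ) →
  mult 1 μ ≤ k
A-addZeros⇒mult1≤ {m} {i} i+k≡m pos (_ , _ , bound) =
  +-cancelˡ-≤ i _ _ (subst₂ _≤_ (pairCount-zero-addZeros i pos) (sym i+k≡m) (bound 0))

T⇒A-addZeros : ∀ {m i k μ} → i + (k ∸ 1) ≤ m → T k (suc m) μ → A i (suc m) (addZeros i μ)
T⇒A-addZeros {m} {i} {k} {μ} ik (l , pos , gap , m1) =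
  addZeros-nonIncreasing i l , ≤-reflexive (mult-zero-addZeros i pos) , bound
  where
  bound : ∀ u → pairCount u (addZeros i μ) ≤ m
  bound zero = subst (_≤ m) (sym (pairCount-zero-addZeros i pos)) (≤-trans (+-monoʳ-≤ i m1) ik)
  bound (suc u) = subst (_≤ m) (sym (pairCount-suc-addZeros u i pos)) (gap⇒pairCount≤ l gap (suc u))

Bgen-addZeros⇒U : ∀ c {n i k μ} → NonIncreasing μ → AllPositive μ → k % 2 ≡ c % 2 → mult 1 μ ≤ k →
  Bgen c i (suc (suc n)) (addZeros i μ) → U (suc k) (suc (suc n)) μ
Bgen-addZeros⇒U c {n} {i} {k} {μ} l pos k≡c m1 (a , par) =
  A-addZeros⇒T {k = suc k} l pos a m1 ,
  pairParity⇒windowParity {k} l pos (A-addZeros⇒pairCount≤ a) parity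
  where
  parity : ∀ u → PairParity k (suc n) (suc u) μ
  parity u = pairParity-cong {k} {suc n} {suc u} {addZeros i μ} {μ}
               (mult-suc-addZeros u i pos) (mult-suc-addZeros (suc u) i pos)
               (λ count≡ → trans (par (suc u) count≡) (sym k≡c))

U⇒Bgen-addZeros : ∀ c {n i k μ} → k % 2 ≡ c % 2 → i + k ≤ suc n →
  (i + mult 1 μ ≡ suc n → mult 1 μ % 2 ≡ c % 2) →
  U (suc k) (suc (suc n)) μ → Bgen c i (suc (suc n)) (addZeros i μ)
U⇒Bgen-addZeros c {n} {i} {k} {μ} k≡c ik parity₀ (t@(l , pos , _) , windowParity) =
  T⇒A-addZeros {k = suc k} ik t , parity
  where
  parity : ∀ u → PairParity c (suc n) u (addZeros i μ)
  parity zero count≡ =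
    trans (cong (_% 2) (pairWeight-zero-addZeros i pos))
          (parity₀ (trans (sym (pairCount-zero-addZeros i pos)) count≡))
  parity (suc u) = pairParity-cong {c} {suc n} {suc u} {μ} {addZeros i μ}
                     (sym (mult-suc-addZeros u i pos)) (sym (mult-suc-addZeros (suc u) i pos))
                     (λ count≡ → trans (windowParity⇒pairParity {k} l windowParity (suc u) count≡) k≡c)

A-lowerZeros : ∀ {j r xs} → A (suc j) r xs → mult 0 xs ≤ j → A j r xs
A-lowerZeros (l , _ , bound) z = l , z , bound

Bgen-lowerZeros : ∀ {c c' j r xs} → c % 2 ≡ c' % 2 → Bgen c (suc j) r xs → mult 0 xs ≤ j →
  Bgen c' j r xs
Bgen-lowerZeros {r = r} c≡c' (a , par) z =
  A-lowerZeros {r = r} a z , λ u count≡ → trans (par u count≡) c≡c'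

A⇒Prev : ∀ {i r xs} → A i r xs → mult 0 xs < i → Prev A i r xs
A⇒Prev {suc j} {r} a (s≤s z) = A-lowerZeros {r = r} a z

-- (2 + x) % 2 and x % 2 are definitionally equal.
B⇒Prev : ∀ {n i xs} → i ≤ suc n → B i (suc (suc n)) xs → mult 0 xs < i →
  Prev B̃ i (suc (suc n)) xs
B⇒Prev {n} {suc j} (s≤s j≤n) b (s≤s z) =
  Bgen-lowerZeros {n ∸ j} {suc (suc n) ∸ j} {r = suc (suc n)} (cong (_% 2) (sym (+-∸-assoc 2 j≤n))) b z

B̃⇒Prev : ∀ {n i xs} → B̃ i (suc (suc n)) xs → mult 0 xs < i → Prev B i (suc (suc n)) xs
B̃⇒Prev {n} {suc j} b (s≤s z) = Bgen-lowerZeros {suc n ∸ j} {suc n ∸ j} {r = suc (suc n)} refl b z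

-- r is explicit since A i r mentions it only through r ∸ 1, which blocks its inference.
A-shape : ∀ r {i xs} → A i r xs → NonIncreasing xs × mult 0 xs ≤ i
A-shape _ (l , z , _) = l , z

B-shape : ∀ r {i xs} → B i r xs → NonIncreasing xs × mult 0 xs ≤ i
B-shape r = A-shape r ∘ proj₁

B̃-shape : ∀ r {i xs} → B̃ i r xs → NonIncreasing xs × mult 0 xs ≤ i
B̃-shape r = A-shape r ∘ proj₁

exactZeros : ∀ {S S' : List ℕ → Set} {i xs} → (S xs → NonIncreasing xs × mult 0 xs ≤ i) →
  (S xs → mult 0 xs < i → S' xs) → (S ∖ S') xs → NonIncreasing xs × mult 0 xs ≡ i
exactZeros shape lower (s , ¬s') with l , z≤i ← shape s = l , ≤-antisym z≤i (≮⇒≥ (¬s' ∘ lower s))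

mult0≡⇒¬Prev : ∀ {S : ℕ → ℕ → List ℕ → Set} {i r xs} → (∀ {j} → S j r xs → mult 0 xs ≤ j) →
  mult 0 xs ≡ i → ¬ Prev S i r xs
mult0≡⇒¬Prev {i = suc j} bound z≡ s = 1+n≰n (subst (_≤ j) z≡ (bound s))

removeZeros-WPBij : ∀ {S T' : List ℕ → Set} {i} →
  (∀ {xs} → S xs → NonIncreasing xs × mult 0 xs ≡ i) →
  (∀ {μ} → T' μ → AllPositive μ) →
  (∀ {μ} → NonIncreasing μ → AllPositive μ → S (addZeros i μ) → T' μ) →
  (∀ {μ} → T' μ → S (addZeros i μ)) →
  WPBij S T' i
removeZeros-WPBij {S} {T'} {i} shape positive to from = record
  { forward     = λ xs s → to (removeZeros-nonIncreasing (proj₁ (shape s))) (removeZeros-positive xs)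
                              (subst S (sym (addZeros-removeZeros′ xs s)) s)
  ; weight-pres = λ xs _ → weight-removeZeros xs
  ; backward    = λ _ → from
  ; left-inv    = addZeros-removeZeros′
  ; right-inv   = λ _ t → removeZeros-addZeros i (positive t)
  }
  where
  addZeros-removeZeros′ : ∀ xs → S xs → addZeros i (removeZeros xs) ≡ xs
  addZeros-removeZeros′ xs s with l , z≡i ← shape s =
    subst (λ z → addZeros z (removeZeros xs) ≡ xs) z≡i (addZeros-removeZeros l)

A∖Prev≃T : ∀ {m i k} → i + k ≡ m → WPBij (A i (suc m) ∖ Prev A i (suc m)) (T (suc k) (suc m)) i
A∖Prev≃T {m} {i} {k} i+k≡m = removeZeros-WPBij shape (λ (_ , pos , _) → pos) to from
  where
  S = A i (suc m) ∖ Prev A i (suc m)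
  shape : ∀ {xs} → S xs → NonIncreasing xs × mult 0 xs ≡ i
  shape = exactZeros {A i (suc m)} {Prev A i (suc m)} (A-shape (suc m)) A⇒Prev
  to : ∀ {μ} → NonIncreasing μ → AllPositive μ → S (addZeros i μ) → T (suc k) (suc m) μ
  to l pos (a , _) = A-addZeros⇒T {k = suc k} l pos a (A-addZeros⇒mult1≤ i+k≡m pos a)
  from : ∀ {μ} → T (suc k) (suc m) μ → S (addZeros i μ)
  from t@(_ , pos , _) = T⇒A-addZeros {k = suc k} (≤-reflexive i+k≡m) t ,
                         mult0≡⇒¬Prev (proj₂ ∘ A-shape (suc m)) (mult-zero-addZeros i pos)

B∖Prev≃U : ∀ {n i k} → i + k ≡ suc n →
  WPBij (B i (suc (suc n)) ∖ Prev B̃ i (suc (suc n))) (U (suc k) (suc (suc n))) i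
B∖Prev≃U {n} {i} {k} i+k≡1+n = removeZeros-WPBij shape (λ ((_ , pos , _) , _) → pos) to from
  where
  r = suc (suc n)
  S = B i r ∖ Prev B̃ i r
  residue : k % 2 ≡ (suc n ∸ i) % 2
  residue = cong (_% 2) (sym (+⇒∸ i i+k≡1+n))
  parity₀ : ∀ {f₁} → i + f₁ ≡ suc n → f₁ % 2 ≡ (suc n ∸ i) % 2
  parity₀ i+f₁≡1+n = cong (_% 2) (sym (+⇒∸ i i+f₁≡1+n))
  shape : ∀ {xs} → S xs → NonIncreasing xs × mult 0 xs ≡ i
  shape = exactZeros {B i r} {Prev B̃ i r} (B-shape r) (B⇒Prev (m+n≤o⇒m≤o i (≤-reflexive i+k≡1+n)))
  to : ∀ {μ} → NonIncreasing μ → AllPositive μ → S (addZeros i μ) → U (suc k) r μ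
  to l pos (b@(a , _) , _) =
    Bgen-addZeros⇒U (suc n ∸ i) l pos residue (A-addZeros⇒mult1≤ i+k≡1+n pos a) b
  from : ∀ {μ} → U (suc k) r μ → S (addZeros i μ)
  from u@((_ , pos , _) , _) = U⇒Bgen-addZeros (suc n ∸ i) residue (≤-reflexive i+k≡1+n) parity₀ u ,
                               mult0≡⇒¬Prev (proj₂ ∘ B̃-shape r) (mult-zero-addZeros i pos)

B̃-addZeros⇒mult1< : ∀ {n i k μ} → i + k ≡ suc n → AllPositive μ → B̃ i (suc (suc n)) (addZeros i μ) →
  mult 1 μ < k
B̃-addZeros⇒mult1< {n} {i} {k} {μ} i+k≡1+n pos (a , parity) =
  ≤∧≢⇒< (A-addZeros⇒mult1≤ i+k≡1+n pos a) λ f₁≡k → %2-suc-≢ k (begin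
    k % 2                             ≡⟨ cong (_% 2) (sym (trans (pairWeight-zero-addZeros i pos) f₁≡k)) ⟩
    pairWeight 0 (addZeros i μ) % 2   ≡⟨ parity 0 (count≡ f₁≡k) ⟩
    (suc (suc n) ∸ i) % 2             ≡⟨ cong (_% 2) (+⇒∸ i (trans (+-suc i k) (cong suc i+k≡1+n))) ⟩
    suc k % 2                         ∎)
  where
  open ≡-Reasoning
  count≡ : mult 1 μ ≡ k → pairCount 0 (addZeros i μ) ≡ suc n
  count≡ f₁≡k = trans (pairCount-zero-addZeros i pos) (trans (cong (i +_) f₁≡k) i+k≡1+n)

B̃∖Prev≃U : ∀ {n i k} → i + k ≡ suc n →
  WPBij (B̃ i (suc (suc n)) ∖ Prev B i (suc (suc n))) (U k (suc (suc n))) i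
B̃∖Prev≃U {n} {i} {zero} i+0≡1+n = removeZeros-WPBij
  (exactZeros {B̃ i (suc (suc n))} {Prev B i (suc (suc n))} (B̃-shape (suc (suc n))) B̃⇒Prev)
  (λ ())
  (λ _ pos (b , _) → contradiction (B̃-addZeros⇒mult1< i+0≡1+n pos b) n≮0)
  (λ ())
B̃∖Prev≃U {n} {i} {suc k} i+1+k≡1+n = removeZeros-WPBij shape (λ ((_ , pos , _) , _) → pos) to from
  where
  r = suc (suc n)
  S = B̃ i r ∖ Prev B i r
  residue : k % 2 ≡ (r ∸ i) % 2
  residue = cong (_% 2) (sym (+⇒∸ i (trans (+-suc i (suc k)) (cong suc i+1+k≡1+n))))
  i+k≤1+n : i + k ≤ suc n
  i+k≤1+n = ≤-trans (+-monoʳ-≤ i (n≤1+n k)) (≤-reflexive i+1+k≡1+n)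
  parity₀ : ∀ {f₁} → f₁ ≤ k → i + f₁ ≡ suc n → f₁ % 2 ≡ (r ∸ i) % 2
  parity₀ f₁≤k i+f₁≡1+n = contradiction (+-cancelˡ-≡ i _ _ (trans i+f₁≡1+n (sym i+1+k≡1+n)))
                                        (λ f₁≡1+k → 1+n≰n (subst (_≤ k) f₁≡1+k f₁≤k))
  shape : ∀ {xs} → S xs → NonIncreasing xs × mult 0 xs ≡ i
  shape = exactZeros {B̃ i r} {Prev B i r} (B̃-shape r) B̃⇒Prev
  to : ∀ {μ} → NonIncreasing μ → AllPositive μ → S (addZeros i μ) → U (suc k) r μ
  to l pos (b , _) =
    Bgen-addZeros⇒U (r ∸ i) l pos residue (≤-pred (B̃-addZeros⇒mult1< i+1+k≡1+n pos b)) b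
  from : ∀ {μ} → U (suc k) r μ → S (addZeros i μ)
  from u@((_ , pos , _ , f₁≤k) , _) = U⇒Bgen-addZeros (r ∸ i) residue i+k≤1+n (parity₀ f₁≤k) u ,
                                      mult0≡⇒¬Prev (proj₂ ∘ B-shape r) (mult-zero-addZeros i pos)

mainTheorem6 : (r i : ℕ) → 2 ≤ r → i ≤ r ∸ 1 →
    WPBij (A i r ∖ Prev A i r) (T (r ∸ i) r) i
    × WPBij (B i r ∖ Prev B̃ i r) (U (r ∸ i) r) i
    × WPBij (B̃ i r ∖ Prev B i r) (U (r ∸ i ∸ 1) r) i
mainTheorem6 (suc zero) i (s≤s ()) _
mainTheorem6 (suc (suc n)) i _ i≤1+n =
    subst (λ k → WPBij (A i r ∖ Prev A i r) (T k r) i) (sym r∸i≡1+k) (A∖Prev≃T i+k≡1+n)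
  , subst (λ k → WPBij (B i r ∖ Prev B̃ i r) (U k r) i) (sym r∸i≡1+k) (B∖Prev≃U i+k≡1+n)
  , subst (λ k → WPBij (B̃ i r ∖ Prev B i r) (U (k ∸ 1) r) i) (sym r∸i≡1+k) (B̃∖Prev≃U i+k≡1+n)
  where
  r = suc (suc n)
  r∸i≡1+k : r ∸ i ≡ suc (suc n ∸ i)
  r∸i≡1+k = +-∸-assoc 1 i≤1+n
  i+k≡1+n : i + (suc n ∸ i) ≡ suc n
  i+k≡1+n = m+[n∸m]≡n i≤1+n
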